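{- Let $\pi$ be a parking function of length $n$. Every record of $\mathrm{PT}(\pi)$ is a record (left-to-right maximum) of the word $\omega_\pi(1)\omega_\pi(2)\cdots\omega_\pi(n)$.
   Context: A parking function of length $n$ is a sequence $\pi=(a_1,\dots,a_n)$ in $[n]=\{1,\dots,n\}$ such that when cars $1,\dots,n$ enter in order a street with spots $1,\dots,n$, car $i$ parking in the first free spot $j\ge a_i$, all cars park. $\omega_\pi(j)$ is the car parked in spot $j$, $\omega_\pi(0)=0$. The parking tree $\mathrm{PT}(\pi)$ is the tree on vertex set $\{0,\dots,n\}$ rooted at $0$ with parent map $f_\pi(i)=\omega_\pi(\pi(i)-1)$. A non-root vertex $k$ of a tree rooted at $0$ is a record if $k$ is the largest label on the path from $k$ to the root. -}

module Defs where

open import Data.Nat using (ℕ; zero; suc; _∸_; _≤_; _<_; _≡ᵇ_)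
open import Data.Bool using (if_then_else_)
open import Data.List using (List; []; _∷_)
open import Data.Maybe using (Maybe; just; nothing)
open import Data.Product using (∃; _×_)
open import Relation.Binary.PropositionalEquality using (_≡_)
open import Data.Nat using (ℕ)

-- A street configuration: spot j ↦ car parked there (0 = empty).
-- Spots are 1..n; spot 0 is never occupied, so ω 0 = 0.
Street : Set
Street = ℕ → ℕ

empty : Street
empty _ = 0

update : Street → ℕ → ℕ → Street
update s j c x = if x ≡ᵇ j then c else s x

search : Street → ℕ → ℕ → Maybe ℕ
search s j zero = nothing
search s j (suc f) = if s j ≡ᵇ 0 then just j else search s (suc j) f

firstFree : ℕ → Street → ℕ → Maybe ℕ
firstFree n s a = search s a (suc n ∸ a)

parkFrom : ℕ → ℕ → List ℕ → Street → Maybe Street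
parkFrom n c [] s = just s
parkFrom n c (a ∷ as) s with firstFree n s a
... | nothing = nothing
... | just j = parkFrom n (suc c) as (update s j c)

-- park n π = just ω  iff all cars park on street 1..n, with ω = ω_π
park : ℕ → List ℕ → Maybe Street
park n π = parkFrom n 1 π empty

-- i-th entry (1-based) of a list, default 0
nth : List ℕ → ℕ → ℕ
nth [] _ = 0
nth (a ∷ as) zero = 0
nth (a ∷ as) (suc zero) = a
nth (a ∷ as) (suc (suc i)) = nth as (suc i)

-- parent map of the parking tree: f_π(i) = ω_π(π(i) - 1) for i ≥ 1;
-- the root 0 is mapped to itself (so iterating stays at the root).
parent : List ℕ → Street → ℕ → ℕ
parent π ω zero = 0
parent π ω (suc i) = ω (nth π (suc i) ∸ 1)

iter : (ℕ → ℕ) → ℕ → ℕ → ℕ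
iter f zero x = x
iter f (suc m) x = f (iter f m x)

IsTreeRecord : (ℕ → ℕ) → ℕ → Set
IsTreeRecord f k = 1 ≤ k × (∀ m → iter f m k ≤ k)

IsWordRecord : ℕ → Street → ℕ → Set
IsWordRecord n ω k =
  ∃ λ j → 1 ≤ j × j ≤ n × ω j ≡ k × (∀ i → 1 ≤ i → i < j → ω i < ω j)

{-# OPTIONS --safe #-}
module Submission where

-- When a car with preference a parks at spot j, the spots a, …, j − 1 it passes are taken
-- by earlier, hence smaller, cars; and since the street ends up full, spot a − 1 holds its
-- parent in the parking tree. So if every vertex on the tree path of the car at spot j is
-- at most k, then by induction on j so is every car in spots 1, …, j: those in a, …, j − 1
-- lie below the car itself and those in 1, …, a − 1 are handled by the parent's spot. For
-- a tree record k this bounds all cars left of k's spot, strictly by injectivity.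

open import Defs
open import Data.Nat using (ℕ; zero; suc; _+_; _∸_; _≤_; _<_; _≡ᵇ_; z≤n; s≤s; z<s; _≟_; _≤?_)
open import Data.Nat.Properties
open import Data.Nat.Induction using (<-rec)
open import Data.Bool using (true; false)
open import Data.List using (List; length; []; _∷_)
open import Data.List.Relation.Unary.All using (All; []; _∷_)
open import Data.Product using (_×_; _,_; ∃; proj₂)
open import Data.Sum using (inj₁; inj₂)
open import Data.Maybe using (just)
open import Relation.Nullary using (yes; no; contradiction)
open import Relation.Binary.PropositionalEquality
open import Function using (_∘_)

update-≡ : ∀ s j c → update s j c j ≡ c
update-≡ s j c with j ≡ᵇ j | ≡⇒≡ᵇ j j refl
... | true | _ = refl

update-≢ : ∀ s j c {x} → x ≢ j → update s j c x ≡ s x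
update-≢ s j c {x} x≢j with x ≡ᵇ j | ≡ᵇ⇒≡ x j
... | false | _ = refl
... | true | x≡j = contradiction (x≡j _) x≢j

sign : ℕ → ℕ
sign zero = 0
sign (suc _) = 1

occupied : Street → ℕ → ℕ
occupied s zero = 0
occupied s (suc m) = sign (s (suc m)) + occupied s m

sign≤1 : ∀ x → sign x ≤ 1
sign≤1 zero = z≤n
sign≤1 (suc x) = ≤-refl

occupied≤ : ∀ s m → occupied s m ≤ m
occupied≤ s zero = z≤n
occupied≤ s (suc m) = +-mono-≤ (sign≤1 (s (suc m))) (occupied≤ s m)

occupied-empty : ∀ m → occupied empty m ≡ 0
occupied-empty zero = refl
occupied-empty (suc m) = occupied-empty m

occupied-cong : ∀ {s t} m → (∀ {i} → i ≤ m → s i ≡ t i) → occupied s m ≡ occupied t m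
occupied-cong zero s≗t = refl
occupied-cong (suc m) s≗t =
  cong₂ _+_ (cong sign (s≗t ≤-refl)) (occupied-cong m (λ i≤m → s≗t (m≤n⇒m≤1+n i≤m)))

occupied-hole : ∀ s m {i} → 1 ≤ i → i ≤ m → s i ≡ 0 → occupied s m < m
occupied-hole s zero (s≤s _) ()
occupied-hole s (suc m) {i} 1≤i i≤1+m si≡0 with m≤n⇒m<n∨m≡n i≤1+m
... | inj₁ i≤m = +-mono-≤-< (sign≤1 (s (suc m))) (occupied-hole s m 1≤i (≤-pred i≤m) si≡0)
... | inj₂ refl rewrite si≡0 = s≤s (occupied≤ s m)

occupied⇒full : ∀ s m → occupied s m ≡ m → ∀ {i} → 1 ≤ i → i ≤ m → s i ≢ 0
occupied⇒full s m full 1≤i i≤m si≡0 = <-irrefl full (occupied-hole s m 1≤i i≤m si≡0)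

occupied-update : ∀ s m {j} c → 1 ≤ j → j ≤ m → s j ≡ 0 →
  occupied (update s j (suc c)) m ≡ suc (occupied s m)
occupied-update s zero c (s≤s _) ()
occupied-update s (suc m) {j} c 1≤j j≤1+m sj≡0 with m≤n⇒m<n∨m≡n j≤1+m
... | inj₁ j≤m rewrite update-≢ s j (suc c) (>⇒≢ j≤m) =
  trans (cong (sign (s (suc m)) +_) (occupied-update s m c 1≤j (≤-pred j≤m) sj≡0))
        (+-suc (sign (s (suc m))) (occupied s m))
... | inj₂ refl rewrite update-≡ s j (suc c) | sj≡0 =
  cong suc (occupied-cong m (λ i≤m → update-≢ s j (suc c) (<⇒≢ (s≤s i≤m))))

iter-shift : ∀ (f : ℕ → ℕ) m x → iter f m (f x) ≡ iter f (suc m) x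
iter-shift f zero x = refl
iter-shift f (suc m) x = cong f (iter-shift f m x)

PathBoundedBy : (ℕ → ℕ) → ℕ → ℕ → Set
PathBoundedBy f k x = ∀ m → iter f m x ≤ k

PathBoundedBy-step : ∀ {f k x} → PathBoundedBy f k x → PathBoundedBy f k (f x)
PathBoundedBy-step {f} {k} {x} bounded m = subst (_≤ k) (sym (iter-shift f m x)) (bounded (suc m))

FirstFreeFrom : Street → ℕ → ℕ → Set
FirstFreeFrom s a r = a ≤ r × s r ≡ 0 × (∀ i → a ≤ i → i < r → s i ≢ 0)

search-sound : ∀ s a f {r} → search s a f ≡ just r → FirstFreeFrom s a r × r < a + f
search-sound s a (suc f) eq with s a in sa
search-sound s a (suc f) refl | zero =
  (≤-refl , sa , λ i a≤i i<a → contradiction a≤i (<⇒≱ i<a)) , m<m+n a z<s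
search-sound s a (suc f) {r} eq | suc _ with search-sound s (suc a) f eq
... | (a<r , sr≡0 , skipped) , r<1+a+f =
  (<⇒≤ a<r , sr≡0 , skipped′) , subst (r <_) (sym (+-suc a f)) r<1+a+f
  where
  skipped′ : ∀ i → a ≤ i → i < r → s i ≢ 0
  skipped′ i a≤i i<r with m≤n⇒m<n∨m≡n a≤i
  ... | inj₁ a<i = skipped i a<i i<r
  ... | inj₂ refl = λ si≡0 → 1+n≢0 (trans (sym sa) si≡0)

firstFree-sound : ∀ n s {a r} → a ≤ n → firstFree n s a ≡ just r → FirstFreeFrom s a r × r ≤ n
firstFree-sound n s {a} {r} a≤n eq with search-sound s a (suc n ∸ a) eq
... | free , r<a+[1+n∸a] = free , ≤-pred (subst (r <_) (m+[n∸m]≡n (m≤n⇒m≤1+n a≤n)) r<a+[1+n∸a])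

parkFrom-∷ : ∀ n c a as s {ω} → parkFrom n c (a ∷ as) s ≡ just ω →
  ∃ λ j → firstFree n s a ≡ just j × parkFrom n (suc c) as (update s j c) ≡ just ω
parkFrom-∷ n c a as s eq with firstFree n s a
... | just j = j , refl , eq

module Parking (n : ℕ) (pref : ℕ → ℕ) where

  record Parked (k : ℕ) (s : Street) : Set where
    field
      inStreet       : ∀ j → s j ≢ 0 → 1 ≤ j × j ≤ n
      occupied≡      : occupied s n ≡ k
      car≤           : ∀ j → s j ≤ k
      pref≤spot      : ∀ j → s j ≢ 0 → pref (s j) ≤ j
      skippedEarlier : ∀ j → s j ≢ 0 → ∀ i → pref (s j) ≤ i → i < j → s i ≢ 0 × s i < s j
      injective      : ∀ i j → s i ≡ s j → s i ≢ 0 → i ≡ j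
      surjective     : ∀ c → 1 ≤ c → c ≤ k → ∃ λ j → s j ≡ c
  open Parked

  empty-Parked : Parked 0 empty
  empty-Parked = record
    { inStreet       = λ _ 0≢0 → contradiction refl 0≢0
    ; occupied≡      = occupied-empty n
    ; car≤           = λ _ → z≤n
    ; pref≤spot      = λ _ 0≢0 → contradiction refl 0≢0
    ; skippedEarlier = λ _ 0≢0 → contradiction refl 0≢0
    ; injective      = λ _ _ _ 0≢0 → contradiction refl 0≢0
    ; surjective     = λ { _ (s≤s _) () }
    }

  Parked-update : ∀ {k s j} → Parked k s → 1 ≤ j → j ≤ n →
    FirstFreeFrom s (pref (suc k)) j → Parked (suc k) (update s j (suc k))
  Parked-update {k} {s} {j} p 1≤j j≤n (a≤j , sj≡0 , skipped) = record
    { inStreet       = inStreet′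
    ; occupied≡      = trans (occupied-update s n k 1≤j j≤n sj≡0) (cong suc (occupied≡ p))
    ; car≤           = car≤′
    ; pref≤spot      = pref≤spot′
    ; skippedEarlier = skippedEarlier′
    ; injective      = injective′
    ; surjective     = surjective′
    }
    where
    s′ : Street
    s′ = update s j (suc k)

    occupied⇒≢j : ∀ {i} → s i ≢ 0 → i ≢ j
    occupied⇒≢j si≢0 refl = si≢0 sj≡0

    inStreet′ : ∀ x → s′ x ≢ 0 → 1 ≤ x × x ≤ n
    inStreet′ x s′x≢0 with x ≟ j
    ... | yes refl = 1≤j , j≤n
    ... | no x≢j rewrite update-≢ s j (suc k) x≢j = inStreet p x s′x≢0

    car≤′ : ∀ x → s′ x ≤ suc k
    car≤′ x with x ≟ j
    ... | yes refl rewrite update-≡ s x (suc k) = ≤-refl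
    ... | no x≢j rewrite update-≢ s j (suc k) x≢j = m≤n⇒m≤1+n (car≤ p x)

    pref≤spot′ : ∀ x → s′ x ≢ 0 → pref (s′ x) ≤ x
    pref≤spot′ x s′x≢0 with x ≟ j
    ... | yes refl rewrite update-≡ s x (suc k) = a≤j
    ... | no x≢j rewrite update-≢ s j (suc k) x≢j = pref≤spot p x s′x≢0

    skippedEarlier′ : ∀ x → s′ x ≢ 0 → ∀ i → pref (s′ x) ≤ i → i < x → s′ i ≢ 0 × s′ i < s′ x
    skippedEarlier′ x s′x≢0 i a≤i i<x with x ≟ j
    ... | yes refl rewrite update-≡ s x (suc k)
                         | update-≢ s x (suc k) (occupied⇒≢j (skipped i a≤i i<x)) =
      skipped i a≤i i<x , s≤s (car≤ p i)
    ... | no x≢j rewrite update-≢ s j (suc k) x≢j with skippedEarlier p x s′x≢0 i a≤i i<x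
    ...   | si≢0 , si<sx rewrite update-≢ s j (suc k) (occupied⇒≢j si≢0) = si≢0 , si<sx

    newcomer-unique : ∀ {x} → x ≢ j → s′ j ≢ s′ x
    newcomer-unique {x} x≢j eq rewrite update-≡ s j (suc k) | update-≢ s j (suc k) x≢j =
      <-irrefl (sym eq) (s≤s (car≤ p x))

    injective′ : ∀ x y → s′ x ≡ s′ y → s′ x ≢ 0 → x ≡ y
    injective′ x y eq s′x≢0 with x ≟ j | y ≟ j
    ... | yes refl | yes refl = refl
    ... | yes refl | no y≢j = contradiction eq (newcomer-unique y≢j)
    ... | no x≢j | yes refl = contradiction (sym eq) (newcomer-unique x≢j)
    ... | no x≢j | no y≢j rewrite update-≢ s j (suc k) x≢j | update-≢ s j (suc k) y≢j =
      injective p x y eq s′x≢0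

    surjective′ : ∀ c → 1 ≤ c → c ≤ suc k → ∃ λ x → s′ x ≡ c
    surjective′ c 1≤c c≤1+k with m≤n⇒m<n∨m≡n c≤1+k
    ... | inj₂ refl = j , update-≡ s j c
    ... | inj₁ c≤k with surjective p c 1≤c (≤-pred c≤k)
    ...   | x , sx≡c =
      x , trans (update-≢ s j (suc k) (occupied⇒≢j (n>0⇒n≢0 (subst (0 <_) (sym sx≡c) 1≤c)))) sx≡c

  parkFrom-Parked : ∀ as k {s ω} → Parked k s → (∀ i → nth as (suc i) ≡ pref (suc (i + k))) →
    All (λ a → 1 ≤ a × a ≤ n) as → parkFrom n (suc k) as s ≡ just ω → Parked (length as + k) ω
  parkFrom-Parked [] k p _ [] refl = p
  parkFrom-Parked (a ∷ as) k {s} {ω} p prefs ((1≤a , a≤n) ∷ valid) eq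
    with parkFrom-∷ n (suc k) a as s eq
  ... | j , free , eq′ with firstFree-sound n s a≤n free
  ...   | first@(a≤j , _) , j≤n =
    subst (λ m → Parked m ω) (+-suc (length as) k)
      (parkFrom-Parked as (suc k) p′ prefs′ valid eq′)
    where
    p′ : Parked (suc k) (update s j (suc k))
    p′ = Parked-update p (≤-trans 1≤a a≤j) j≤n (subst (λ b → FirstFreeFrom s b j) (prefs 0) first)

    prefs′ : ∀ i → nth as (suc i) ≡ pref (suc (i + suc k))
    prefs′ i = trans (prefs (suc i)) (cong (pref ∘ suc) (sym (+-suc i k)))

module FinalStreet (n : ℕ) (π : List ℕ) (ω : Street) (p : Parking.Parked n (nth π) n ω) where
  open Parking n (nth π)
  open Parked p

  full : ∀ {j} → 1 ≤ j → j ≤ n → ω j ≢ 0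
  full = occupied⇒full ω n occupied≡

  parent-nonroot : ∀ {x} → x ≢ 0 → parent π ω x ≡ ω (nth π x ∸ 1)
  parent-nonroot {zero} 0≢0 = contradiction refl 0≢0
  parent-nonroot {suc x} _ = refl

  PrefixBoundedBy : ℕ → ℕ → Set
  PrefixBoundedBy k j =
    1 ≤ j → j ≤ n → PathBoundedBy (parent π ω) k (ω j) → ∀ i → 1 ≤ i → i ≤ j → ω i ≤ k

  pathBounded⇒prefixBounded : ∀ k j → PrefixBoundedBy k j
  pathBounded⇒prefixBounded k = <-rec (PrefixBoundedBy k) step
    where
    step : ∀ j → (∀ {j′} → j′ < j → PrefixBoundedBy k j′) → PrefixBoundedBy k j
    step j ih 1≤j j≤n bounded i 1≤i i≤j with m≤n⇒m<n∨m≡n i≤j | nth π (ω j) ≤? i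
    ... | inj₂ refl | _ = bounded 0
    ... | inj₁ i<j | yes a≤i =
      <⇒≤ (<-≤-trans (proj₂ (skippedEarlier j (full 1≤j j≤n) i a≤i i<j)) (bounded 0))
    ... | inj₁ i<j | no a≰i = ih a∸1<j 1≤a∸1 (≤-trans (<⇒≤ a∸1<j) j≤n) bounded′ i 1≤i i≤a∸1
      where
      a : ℕ
      a = nth π (ω j)
      i<a : i < a
      i<a = ≰⇒> a≰i
      i≤a∸1 : i ≤ a ∸ 1
      i≤a∸1 = ∸-monoˡ-≤ 1 i<a
      1≤a∸1 : 1 ≤ a ∸ 1
      1≤a∸1 = ≤-trans 1≤i i≤a∸1
      a∸1<j : a ∸ 1 < j
      a∸1<j = <-≤-trans (∸-monoʳ-< {a} {1} {0} z<s (≤-trans 1≤i (<⇒≤ i<a)))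
                        (pref≤spot j (full 1≤j j≤n))
      bounded′ : PathBoundedBy (parent π ω) k (ω (a ∸ 1))
      bounded′ = subst (PathBoundedBy (parent π ω) k) (parent-nonroot (full 1≤j j≤n))
                       (PathBoundedBy-step bounded)

  treeRecord⇒wordRecord : ∀ k → k ≤ n → IsTreeRecord (parent π ω) k → IsWordRecord n ω k
  treeRecord⇒wordRecord k k≤n (1≤k , bounded) with surjective k 1≤k k≤n
  ... | j , refl with inStreet j (n>0⇒n≢0 1≤k)
  ...   | 1≤j , j≤n = j , 1≤j , j≤n , refl , earlier
    where
    earlier : ∀ i → 1 ≤ i → i < j → ω i < ω j
    earlier i 1≤i i<j = ≤∧≢⇒<
      (pathBounded⇒prefixBounded (ω j) j 1≤j j≤n bounded i 1≤i (<⇒≤ i<j))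
      (λ ωi≡ωj → <-irrefl (injective i j ωi≡ωj (full 1≤i (≤-trans (<⇒≤ i<j) j≤n))) i<j)

lemma3p11 : (n : ℕ) (π : List ℕ) (ω : Street) →
    length π ≡ n →
    All (λ a → 1 ≤ a × a ≤ n) π →
    park n π ≡ just ω →
    (k : ℕ) → k ≤ n → IsTreeRecord (parent π ω) k → IsWordRecord n ω k
lemma3p11 n π ω len valid parks = FinalStreet.treeRecord⇒wordRecord n π ω parked
  where
  open Parking n (nth π)
  parked : Parked n ω
  parked = subst (λ m → Parked m ω) (trans (+-identityʳ (length π)) len)
    (parkFrom-Parked π 0 empty-Parked (λ i → cong (nth π ∘ suc) (sym (+-identityʳ i))) valid parks)
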